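{- Let $T_0$ be the graph with vertex set $\{v',v,x_0,x,x_1,w,w',u,u'\}$ and edge set $\{v'v,\ vx_0,\ x_0x,\ xx_1,\ x_0x_1,\ x_1w,\ ww',\ xu,\ uu'\}$. Then $T_0$ is not a co-TT graph.
   Context: A graph $G=(V,E)$ is a threshold tolerance graph if each vertex $v$ can be assigned a positive weight $w_v$ and a positive tolerance $t_v$ such that for distinct $u,v$, $uv\in E$ iff $w_u+w_v>\min\{t_u,t_v\}$. A co-TT graph is the complement of a threshold tolerance graph. Equivalently (Monma–Reed–Trotter), $G$ is co-TT iff one can assign positive numbers $a_v,b_v$ to each vertex $v$ such that for distinct $x,y$: $xy\in E$ iff $a_x\le b_y$ and $a_y\le b_x$.
   Formalization: The vertex weights and tolerances of a threshold tolerance graph are taken in the positive rationals. -}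

module Defs where

open import Data.Nat using (ℕ)
open import Data.Fin using (Fin; zero; suc)
open import Data.Bool using (Bool; true; false; T; _∨_)
open import Data.Product using (Σ; _×_)
open import Data.Rational using (ℚ; _+_; _<_; _⊓_; Positive)
open import Relation.Nullary using (¬_)
open import Relation.Binary.PropositionalEquality using (_≡_)
open import Function.Bundles using (_⇔_)

-- A (simple) graph on vertex set Fin n is given by its adjacency relation
-- E; only E u v for distinct u, v matters.

IsTT : (n : ℕ) → (Fin n → Fin n → Set) → Set
IsTT n E =
  Σ (Fin n → ℚ) λ w → Σ (Fin n → ℚ) λ t →
    ((v : Fin n) → Positive (w v) × Positive (t v)) ×
    ((u v : Fin n) → ¬ (u ≡ v) → (E u v ⇔ (t u ⊓ t v < w u + w v)))

Complement : (n : ℕ) → (Fin n → Fin n → Set) → (Fin n → Fin n → Set)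
Complement n E u v = ¬ E u v

IsCoTT : (n : ℕ) → (Fin n → Fin n → Set) → Set
IsCoTT n E = IsTT n (Complement n E)

-- The graph T₀.  Vertex numbering:
--   0 = v', 1 = v, 2 = x₀, 3 = x, 4 = x₁, 5 = w, 6 = w', 7 = u, 8 = u'
-- Edges: v'v, vx₀, x₀x, xx₁, x₀x₁, x₁w, ww', xu, uu'.
T₀-edgeB : Fin 9 → Fin 9 → Bool
T₀-edgeB zero (suc zero) = true
T₀-edgeB (suc zero) (suc (suc zero)) = true
T₀-edgeB (suc (suc zero)) (suc (suc (suc zero))) = true
T₀-edgeB (suc (suc (suc zero))) (suc (suc (suc (suc zero)))) = true
T₀-edgeB (suc (suc zero)) (suc (suc (suc (suc zero)))) = true
T₀-edgeB (suc (suc (suc (suc zero)))) (suc (suc (suc (suc (suc zero))))) = true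
T₀-edgeB (suc (suc (suc (suc (suc zero))))) (suc (suc (suc (suc (suc (suc zero)))))) = true
T₀-edgeB (suc (suc (suc zero))) (suc (suc (suc (suc (suc (suc (suc zero))))))) = true
T₀-edgeB (suc (suc (suc (suc (suc (suc (suc zero))))))) (suc (suc (suc (suc (suc (suc (suc (suc zero)))))))) = true
T₀-edgeB _ _ = false

T₀ : Fin 9 → Fin 9 → Set
T₀ a b = T (T₀-edgeB a b ∨ T₀-edgeB b a)

{-# OPTIONS --safe #-}
-- With a = w and b = t − w, distinct vertices x, y are adjacent in the complement of a
-- threshold tolerance graph iff a x ≤ b y and a y ≤ b x (Monma–Reed–Trotter).
-- In the triangle x₀ x x₁ every corner has a neighbour adjacent to no other corner, so a
-- larger a forces a strictly larger b: sorting the corners y₁, y, y₃ by a sorts them by b.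
-- The neighbour k of the middle corner y is nonadjacent to y₁ and y₃, which forces
-- b y₁ < a k and b k < a y₃; then the end k′ of the pendant path y – k – k′ can lie
-- neither above y (b y < a k′) nor below it (b k′ < a y).
module Submission where

open import Defs
open import Algebra.Properties.Group using (//-rightDividesʳ)
open import Data.Fin using (Fin)
open import Data.Fin.Patterns using (0F; 1F; 2F; 3F; 4F; 5F; 6F; 7F; 8F)
open import Data.Product using (_×_; _,_; proj₁; proj₂)
open import Data.Rational using (ℚ; _+_; _-_; -_; _<_; _≤_; _≮_; _⊓_)
open import Data.Rational.Properties
open import Data.Sum using (_⊎_; inj₁; inj₂; [_,_]′)
open import Data.Empty using (⊥)
open import Function using (_$_; _∘_)
open import Function.Bundles using (Equivalence)
open import Relation.Binary.Definitions using (Irreflexive)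
open import Relation.Binary.PropositionalEquality using (_≡_; _≢_; refl; subst; ≢-sym)
open import Relation.Nullary using (¬_; contradiction)

p+q≤r⇒p≤r-q : ∀ {p q r} → p + q ≤ r → p ≤ r - q
p+q≤r⇒p≤r-q {p} {q} {r} p+q≤r =
  subst (_≤ r - q) (//-rightDividesʳ +-0-group q p) (+-monoˡ-≤ (- q) p+q≤r)

r<p+q⇒r-q<p : ∀ {p q r} → r < p + q → r - q < p
r<p+q⇒r-q<p {p} {q} {r} r<p+q =
  subst (r - q <_) (//-rightDividesʳ +-0-group q p) (+-monoˡ-< (- q) r<p+q)

p⊓q<r⇒p<r⊎q<r : ∀ p q {r} → p ⊓ q < r → p < r ⊎ q < r
p⊓q<r⇒p<r⊎q<r p q p⊓q<r with ⊓-sel p q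
... | inj₁ p⊓q≡p = inj₁ (subst (_< _) p⊓q≡p p⊓q<r)
... | inj₂ p⊓q≡q = inj₂ (subst (_< _) p⊓q≡q p⊓q<r)

record SortedTriple (f : Fin 3 → ℚ) : Set where
  constructor sorted
  field
    lo mid hi : Fin 3
    mid≢lo    : mid ≢ lo
    mid≢hi    : mid ≢ hi
    hi≢lo     : hi ≢ lo
    lo≤mid    : f lo ≤ f mid
    mid≤hi    : f mid ≤ f hi

sortTriple : (f : Fin 3 → ℚ) → SortedTriple f
sortTriple f with ≤-total (f 0F) (f 1F) | ≤-total (f 1F) (f 2F) | ≤-total (f 0F) (f 2F)
... | inj₁ f₀≤f₁ | inj₁ f₁≤f₂ | _          = sorted 0F 1F 2F (λ ()) (λ ()) (λ ()) f₀≤f₁ f₁≤f₂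
... | inj₁ f₀≤f₁ | inj₂ f₂≤f₁ | inj₁ f₀≤f₂ = sorted 0F 2F 1F (λ ()) (λ ()) (λ ()) f₀≤f₂ f₂≤f₁
... | inj₁ f₀≤f₁ | inj₂ f₂≤f₁ | inj₂ f₂≤f₀ = sorted 2F 0F 1F (λ ()) (λ ()) (λ ()) f₂≤f₀ f₀≤f₁
... | inj₂ f₁≤f₀ | inj₁ f₁≤f₂ | inj₁ f₀≤f₂ = sorted 1F 0F 2F (λ ()) (λ ()) (λ ()) f₁≤f₀ f₀≤f₂
... | inj₂ f₁≤f₀ | inj₁ f₁≤f₂ | inj₂ f₂≤f₀ = sorted 1F 2F 0F (λ ()) (λ ()) (λ ()) f₁≤f₂ f₂≤f₀
... | inj₂ f₁≤f₀ | inj₂ f₂≤f₁ | _          = sorted 2F 1F 0F (λ ()) (λ ()) (λ ()) f₂≤f₁ f₁≤f₀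

offDiagonal : {P : Fin 3 → Fin 3 → Set} →
  P 0F 1F → P 0F 2F → P 1F 0F → P 1F 2F → P 2F 0F → P 2F 1F →
  ∀ {i j} → i ≢ j → P i j
offDiagonal p₀₁ p₀₂ p₁₀ p₁₂ p₂₀ p₂₁ {0F} {0F} i≢j = contradiction refl i≢j
offDiagonal p₀₁ p₀₂ p₁₀ p₁₂ p₂₀ p₂₁ {0F} {1F} _   = p₀₁
offDiagonal p₀₁ p₀₂ p₁₀ p₁₂ p₂₀ p₂₁ {0F} {2F} _   = p₀₂
offDiagonal p₀₁ p₀₂ p₁₀ p₁₂ p₂₀ p₂₁ {1F} {0F} _   = p₁₀
offDiagonal p₀₁ p₀₂ p₁₀ p₁₂ p₂₀ p₂₁ {1F} {1F} i≢j = contradiction refl i≢j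
offDiagonal p₀₁ p₀₂ p₁₀ p₁₂ p₂₀ p₂₁ {1F} {2F} _   = p₁₂
offDiagonal p₀₁ p₀₂ p₁₀ p₁₂ p₂₀ p₂₁ {2F} {0F} _   = p₂₀
offDiagonal p₀₁ p₀₂ p₁₀ p₁₂ p₂₀ p₂₁ {2F} {1F} _   = p₂₁
offDiagonal p₀₁ p₀₂ p₁₀ p₁₂ p₂₀ p₂₁ {2F} {2F} i≢j = contradiction refl i≢j

module _ {V : Set} (E : V → V → Set) where

  Nonadjacent : V → V → Set
  Nonadjacent x y = x ≢ y × ¬ E x y

  record CoTTRepresentation : Set where
    field
      a b          : V → ℚ
      adjacent⇒    : ∀ {x y} → E x y → a x ≤ b y × a y ≤ b x
      nonadjacent⇒ : ∀ {x y} → Nonadjacent x y → b y < a x ⊎ b x < a y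

  -- The net (a triangle with a pendant edge at each corner) with its pendant edges
  -- subdivided, as a not necessarily induced subgraph.
  record SubdividedNet : Set where
    field
      corner leg foot : Fin 3 → V
      corner-corner   : ∀ {i j} → i ≢ j → E (corner i) (corner j)
      corner-leg      : ∀ i → E (corner i) (leg i)
      leg-foot        : ∀ i → E (leg i) (foot i)
      leg≁corner      : ∀ {i j} → i ≢ j → Nonadjacent (leg i) (corner j)
      foot≁corner     : ∀ i → Nonadjacent (foot i) (corner i)

isCoTT⇒coTTRepresentation : ∀ {n} {E : Fin n → Fin n → Set} →
  Irreflexive _≡_ E → IsCoTT n E → CoTTRepresentation E
isCoTT⇒coTTRepresentation {E = E} irrefl (w , t , _ , tolerance) = record
  { a            = w
  ; b            = λ y → t y - w y
  ; adjacent⇒    = adjacent⇒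
  ; nonadjacent⇒ = nonadjacent⇒
  }
  where
  adjacent⇒ : ∀ {x y} → E x y → w x ≤ t y - w y × w y ≤ t x - w x
  adjacent⇒ {x} {y} xy =
    p+q≤r⇒p≤r-q (p≤q⊓r⇒p≤r (t x) (t y) sum≤min) ,
    p+q≤r⇒p≤r-q (subst (_≤ t x) (+-comm (w x) (w y)) (p≤q⊓r⇒p≤q (t x) (t y) sum≤min))
    where
    sum≤min : w x + w y ≤ t x ⊓ t y
    sum≤min = ≮⇒≥ λ min<sum →
      Equivalence.from (tolerance x y (λ x≡y → irrefl x≡y xy)) min<sum xy

  nonadjacent⇒ : ∀ {x y} → Nonadjacent E x y → t y - w y < w x ⊎ t x - w x < w y
  nonadjacent⇒ {x} {y} (x≢y , ¬xy)
    with p⊓q<r⇒p<r⊎q<r (t x) (t y) (Equivalence.to (tolerance x y x≢y) ¬xy)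
  ... | inj₁ tx<sum = inj₂ (r<p+q⇒r-q<p (subst (t x <_) (+-comm (w x) (w y)) tx<sum))
  ... | inj₂ ty<sum = inj₁ (r<p+q⇒r-q<p ty<sum)

module _ {V : Set} {E : V → V → Set} (R : CoTTRepresentation E) where
  open CoTTRepresentation R
  open ≤-Reasoning

  private
    <-cycle : ∀ {p} {A : Set} → p < p → A
    <-cycle p<p = contradiction p<p (<-irrefl refl)

  a≤⇒b< : ∀ {y z m} → E z m → Nonadjacent E m y → a y ≤ a z → b y < b z
  a≤⇒b< {y} {z} {m} zm m≁y ay≤az with nonadjacent⇒ m≁y
  ... | inj₁ by<am = <-≤-trans by<am (proj₂ (adjacent⇒ zm))
  ... | inj₂ bm<ay = <-cycle $ begin-strict
    b m  <⟨ bm<ay ⟩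
    a y  ≤⟨ ay≤az ⟩
    a z  ≤⟨ proj₁ (adjacent⇒ zm) ⟩
    b m  ∎

  pendantPath-notBetween : ∀ {y₁ y y₃ k k′} →
    E y y₁ → E y₃ y₁ → E y k → E k k′ →
    Nonadjacent E k y₁ → Nonadjacent E k y₃ → Nonadjacent E k′ y →
    a y₁ ≤ a y → b y ≤ b y₃ → ⊥
  pendantPath-notBetween {y₁} {y} {y₃} {k} {k′}
    yy₁ y₃y₁ yk kk′ k≁y₁ k≁y₃ k′≁y ay₁≤ay by≤by₃ =
    [ by≮ak′ , bk′≮ay ]′ (nonadjacent⇒ k′≁y)
    where
    by₁<ak : b y₁ < a k
    by₁<ak with nonadjacent⇒ k≁y₁
    ... | inj₁ by₁<ak = by₁<ak
    ... | inj₂ bk<ay₁ = <-cycle $ begin-strict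
      b k   <⟨ bk<ay₁ ⟩
      a y₁  ≤⟨ ay₁≤ay ⟩
      a y   ≤⟨ proj₁ (adjacent⇒ yk) ⟩
      b k   ∎

    bk<ay₃ : b k < a y₃
    bk<ay₃ with nonadjacent⇒ k≁y₃
    ... | inj₂ bk<ay₃ = bk<ay₃
    ... | inj₁ by₃<ak = <-cycle $ begin-strict
      b y₃  <⟨ by₃<ak ⟩
      a k   ≤⟨ proj₂ (adjacent⇒ yk) ⟩
      b y   ≤⟨ by≤by₃ ⟩
      b y₃  ∎

    by≮ak′ : b y ≮ a k′
    by≮ak′ by<ak′ = <-cycle $ begin-strict
      b y   <⟨ by<ak′ ⟩
      a k′  ≤⟨ proj₂ (adjacent⇒ kk′) ⟩
      b k   <⟨ bk<ay₃ ⟩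
      a y₃  ≤⟨ proj₁ (adjacent⇒ y₃y₁) ⟩
      b y₁  <⟨ by₁<ak ⟩
      a k   ≤⟨ proj₂ (adjacent⇒ yk) ⟩
      b y   ∎

    bk′≮ay : b k′ ≮ a y
    bk′≮ay bk′<ay = <-cycle $ begin-strict
      b k′  <⟨ bk′<ay ⟩
      a y   ≤⟨ proj₁ (adjacent⇒ yy₁) ⟩
      b y₁  <⟨ by₁<ak ⟩
      a k   ≤⟨ proj₁ (adjacent⇒ kk′) ⟩
      b k′  ∎

  subdividedNet-notSortable : (N : SubdividedNet E) →
    ¬ SortedTriple (a ∘ SubdividedNet.corner N)
  subdividedNet-notSortable N (sorted lo mid hi mid≢lo mid≢hi hi≢lo lo≤mid mid≤hi) =
    pendantPath-notBetween
      (corner-corner mid≢lo) (corner-corner hi≢lo) (corner-leg mid) (leg-foot mid)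
      (leg≁corner mid≢lo) (leg≁corner mid≢hi) (foot≁corner mid)
      lo≤mid (<⇒≤ (a≤⇒b< (corner-leg hi) (leg≁corner (≢-sym mid≢hi)) mid≤hi))
    where open SubdividedNet N

subdividedNet⇒¬coTTRepresentation : ∀ {V} {E : V → V → Set} →
  SubdividedNet E → ¬ CoTTRepresentation E
subdividedNet⇒¬coTTRepresentation N R =
  subdividedNet-notSortable R N (sortTriple (a ∘ corner))
  where open CoTTRepresentation R
        open SubdividedNet N

T₀-irreflexive : Irreflexive _≡_ T₀
T₀-irreflexive {0F} refl ()
T₀-irreflexive {1F} refl ()
T₀-irreflexive {2F} refl ()
T₀-irreflexive {3F} refl ()
T₀-irreflexive {4F} refl ()
T₀-irreflexive {5F} refl ()
T₀-irreflexive {6F} refl ()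
T₀-irreflexive {7F} refl ()
T₀-irreflexive {8F} refl ()

T₀-corner T₀-leg T₀-foot : Fin 3 → Fin 9
T₀-corner = λ { 0F → 2F ; 1F → 3F ; 2F → 4F }
T₀-leg    = λ { 0F → 1F ; 1F → 7F ; 2F → 5F }
T₀-foot   = λ { 0F → 0F ; 1F → 8F ; 2F → 6F }

T₀-subdividedNet : SubdividedNet T₀
T₀-subdividedNet = record
  { corner        = T₀-corner
  ; leg           = T₀-leg
  ; foot          = T₀-foot
  ; corner-corner = offDiagonal {P = λ i j → T₀ (T₀-corner i) (T₀-corner j)} _ _ _ _ _ _
  ; corner-leg    = λ { 0F → _ ; 1F → _ ; 2F → _ }
  ; leg-foot      = λ { 0F → _ ; 1F → _ ; 2F → _ }
  ; leg≁corner    = offDiagonal {P = λ i j → Nonadjacent T₀ (T₀-leg i) (T₀-corner j)}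
                      ((λ ()) , (λ ())) ((λ ()) , (λ ())) ((λ ()) , (λ ()))
                      ((λ ()) , (λ ())) ((λ ()) , (λ ())) ((λ ()) , (λ ()))
  ; foot≁corner   = λ { 0F → (λ ()) , (λ ()) ; 1F → (λ ()) , (λ ()) ; 2F → (λ ()) , (λ ()) }
  }

lemma16 : ¬ IsCoTT 9 T₀
lemma16 = subdividedNet⇒¬coTTRepresentation T₀-subdividedNet
        ∘ isCoTT⇒coTTRepresentation T₀-irreflexive
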